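{- Let $k\ge 3$ and let $D$ be a super-orientation of $\overline{C_{2k+1}}$ with vertices labeled $x_0,\ldots,x_{2k}$ so that the complement of the underlying graph of $D$ is the cycle $(x_0,x_1,\ldots,x_{2k},x_0)$. Let $D'$ be the digraph obtained from $D$ by deleting the vertices $x_0$ and $x_1$ and the arc(s) between $x_2$ and $x_{2k}$ (so $D'$ is a super-orientation of $\overline{C_{2k-1}}$, the complement of the cycle $(x_2,\ldots,x_{2k},x_2)$). If $D'$ has a path partition orthogonal to $\{x_2,x_{2k}\}$, then $D$ has a path partition orthogonal to $\{x_0,x_{2k}\}$.
   Context: A super-orientation of a graph $G$ is a digraph obtained by replacing each edge $uv$ of $G$ by the arc $(u,v)$, the arc $(v,u)$, or both. A path means a directed path (sequence of distinct vertices, each with an arc to its successor). A path partition of a digraph is a collection of vertex-disjoint paths covering all vertices. A stable set $S$ and a path partition $\mathcal{P}$ are orthogonal if every path of $\mathcal{P}$ contains exactly one vertex of $S$. -}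

module Defs where

open import Data.Nat using (ℕ; zero; suc; _*_; _≤_; _≤?_)
open import Data.Nat.Base using (_≡ᵇ_)
open import Data.Bool using (Bool; true; false; if_then_else_; _∨_)
open import Data.Fin using (Fin; toℕ)
open import Data.List using (List; []; _∷_; concat; filter; allFin)
open import Data.List.Relation.Unary.All using (All)
open import Data.List.Relation.Unary.Unique.Propositional using (Unique)
open import Data.List.Relation.Unary.Linked using (Linked)
open import Data.List.Relation.Binary.Permutation.Propositional using (_↭_)
open import Data.Product using (_×_; Σ)
open import Data.Sum using (_⊎_)
open import Relation.Nullary using (¬_)
open import Relation.Binary.PropositionalEquality using (_≡_; _≢_)

Digraph : ℕ → Set₁
Digraph N = Fin N → Fin N → Set

-- u and v are consecutive on the cycle (x_0, x_1, ..., x_{N-1}, x_0),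
-- where vertex v of Fin N is x_{toℕ v}.
CycleAdj : {N : ℕ} → Fin N → Fin N → Set
CycleAdj {N} u v =
  (toℕ v ≡ suc (toℕ u)) ⊎ (toℕ u ≡ suc (toℕ v))
  ⊎ (toℕ u ≡ 0 × suc (toℕ v) ≡ N) ⊎ (toℕ v ≡ 0 × suc (toℕ u) ≡ N)

CoCycleAdj : {N : ℕ} → Fin N → Fin N → Set
CoCycleAdj u v = u ≢ v × ¬ CycleAdj u v

SuperOrientationCoCycle : {N : ℕ} → Digraph N → Set
SuperOrientationCoCycle A =
  ∀ u v → (A u v → CoCycleAdj u v) × (CoCycleAdj u v → A u v ⊎ A v u)

IsPath : {N : ℕ} → Digraph N → List (Fin N) → Set
IsPath A P = P ≢ [] × Unique P × Linked A P

IsPathPartition : {N : ℕ} → Digraph N → List (Fin N) → List (List (Fin N)) → Set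
IsPathPartition A V Ps = All (IsPath A) Ps × concat Ps ↭ V

count : {N : ℕ} → (Fin N → Bool) → List (Fin N) → ℕ
count S [] = 0
count S (x ∷ xs) = if S x then suc (count S xs) else count S xs

Orthogonal : {N : ℕ} → (Fin N → Bool) → List (List (Fin N)) → Set
Orthogonal S Ps = All (λ P → count S P ≡ 1) Ps

S₀ : (k : ℕ) → Fin (suc (2 * k)) → Bool
S₀ k v = (toℕ v ≡ᵇ 0) ∨ (toℕ v ≡ᵇ 2 * k)

S₂ : (k : ℕ) → Fin (suc (2 * k)) → Bool
S₂ k v = (toℕ v ≡ᵇ 2) ∨ (toℕ v ≡ᵇ 2 * k)

V' : (k : ℕ) → List (Fin (suc (2 * k)))
V' k = filter (λ v → 2 ≤? toℕ v) (allFin (suc (2 * k)))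

-- arcs of D': arcs of D except those between x_2 and x_{2k}
-- (only arcs inside V' k matter, since paths of a partition of V' k use only its vertices)
D' : (k : ℕ) → Digraph (suc (2 * k)) → Digraph (suc (2 * k))
D' k A u v =
  A u v × ¬ ((toℕ u ≡ 2 × toℕ v ≡ 2 * k) ⊎ (toℕ u ≡ 2 * k × toℕ v ≡ 2))

{-# OPTIONS --safe #-}
-- A path partition of D' orthogonal to {x₂, x₂ₖ} consists of exactly two paths: P through x₂
-- and Q through x₂ₖ. In the underlying graph of D, x₀ is adjacent to everything except x₁ and
-- x₂ₖ, and x₁ to everything except x₀ and x₂, so x₀ is adjacent to every vertex of P and x₁ to
-- every vertex of Q. A vertex adjacent (in some direction) to every vertex of a path can be
-- inserted into it; inserting x₀ into P and x₁ into Q gives a path partition of D whose first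
-- path contains x₀ and whose second contains x₂ₖ.
module Submission where

open import Defs
open import Data.Bool using (Bool; true; false; _∨_; if_then_else_)
open import Data.Bool.Properties using (T-≡; T-∨; ¬-not)
open import Data.Fin using (Fin; toℕ; fromℕ; fromℕ<) renaming (zero to fzero; suc to fsuc)
open import Data.Fin.Properties using (toℕ-fromℕ; toℕ-fromℕ<; toℕ-injective)
open import Data.List using (List; []; _∷_; _++_; concat; filter; allFin)
open import Data.List.Membership.Propositional using (_∈_; _∉_; find)
open import Data.List.Membership.Propositional.Properties
  using (∈-∃++; ∈-concat⁻; ∈-++⁻; ∈-++⁺ˡ; ∈-++⁺ʳ; ∈-filter⁺; ∈-filter⁻; ∈-allFin)
open import Data.List.Properties using (filter-all; ++-assoc)
open import Data.List.Relation.Binary.Permutation.Propositional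
  using (_↭_; refl; prep; swap; trans; ↭-refl; ↭-sym; ↭⇒↭ₛ; module PermutationReasoning)
open import Data.List.Relation.Binary.Permutation.Propositional.Properties
  using (All-resp-↭; ∈-resp-↭; ++⁺; ++⁺ˡ; ++⁺ʳ; shift; shifts; ↭-empty-inv)
import Data.List.Relation.Binary.Permutation.Setoid.Properties as Permutationₛ
open import Data.List.Relation.Unary.All as All using (All; []; _∷_)
open import Data.List.Relation.Unary.All.Properties using (¬Any⇒All¬; All¬⇒¬Any; tabulate⁺)
open import Data.List.Relation.Unary.Any using (Any; here; there)
open import Data.List.Relation.Unary.Linked as Linked using (Linked; [-]; _∷_)
open import Data.List.Relation.Unary.Unique.Propositional using (Unique; _∷_)
open import Data.List.Relation.Unary.Unique.Propositional.Properties using (filter⁺; allFin⁺)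
open import Data.Nat using (ℕ; suc; _+_; _*_; _≤_; _<_; _≤?_; _≟_; _≡ᵇ_; z≤n; s≤s)
open import Data.Nat.Properties
  using (≡ᵇ⇒≡; ≡⇒≡ᵇ; ≤-refl; ≤-trans; n≤1+n; 1+n≰n; <⇒≢; <-asym; ≤∧≢⇒<; m≤n*m; suc-injective)
open import Data.Product using (_×_; Σ; ∃; ∃₂; _,_; proj₁; proj₂)
open import Data.Sum as Sum using (_⊎_; inj₁; inj₂)
open import Function using (_∘_; case_of_; _⇔_; mk⇔; Equivalence)
open import Relation.Binary.Definitions using (_Respects_)
open import Relation.Binary.PropositionalEquality as ≡
  using (_≡_; _≢_; refl; sym; cong; cong₂; subst)
open import Relation.Nullary using (¬_; contradiction)
open import Relation.Nullary.Decidable using (dec-false)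
open import Relation.Unary using (Pred)
open import Level using (Level)

private
  variable
    a : Level
    A : Set a
    n : ℕ
    x : A
    xs ys : List A

Unique-resp-↭ : Unique {A = A} Respects _↭_
Unique-resp-↭ p = Permutationₛ.Unique-resp-↭ (≡.setoid _) (↭⇒↭ₛ p)

Unique-++⇒disjoint : ∀ xs → Unique (xs ++ ys) → x ∈ xs → x ∉ ys
Unique-++⇒disjoint (_ ∷ xs) (x≢ ∷ _) (here refl) x∈ys = All.lookup x≢ (∈-++⁺ʳ xs x∈ys) refl
Unique-++⇒disjoint (_ ∷ xs) (_ ∷ u) (there x∈xs) = Unique-++⇒disjoint xs u x∈xs

concat-↭ : {xss yss : List (List A)} → xss ↭ yss → concat xss ↭ concat yss
concat-↭ refl = ↭-refl
concat-↭ (prep xs p) = ++⁺ˡ xs (concat-↭ p)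
concat-↭ (swap xs ys p) = trans (shifts xs ys) (++⁺ˡ ys (++⁺ˡ xs (concat-↭ p)))
concat-↭ (trans p q) = trans (concat-↭ p) (concat-↭ q)

Any⇒↭∷ : {P : Pred A a} → Any P xs → ∃₂ λ x rest → P x × xs ↭ x ∷ rest
Any⇒↭∷ any with x , x∈xs , px ← find any with ys , zs , refl ← ∈-∃++ x∈xs =
  x , ys ++ zs , px , shift x ys zs

module _ (S : Fin n → Bool) where

  count-∷-true : ∀ x xs → S x ≡ true → count S (x ∷ xs) ≡ suc (count S xs)
  count-∷-true _ _ Sx rewrite Sx = refl

  count-∷-false : ∀ x xs → S x ≡ false → count S (x ∷ xs) ≡ count S xs
  count-∷-false _ _ Sx rewrite Sx = refl

  count-cong : ∀ {S′ xs} → All (λ v → S v ≡ S′ v) xs → count S xs ≡ count S′ xs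
  count-cong [] = refl
  count-cong {S′} {x ∷ _} (Sx≡S′x ∷ Sxs≡S′xs) rewrite Sx≡S′x =
    cong (λ m → if S′ x then suc m else m) (count-cong Sxs≡S′xs)

  count-resp-↭ : ∀ {xs ys} → xs ↭ ys → count S xs ≡ count S ys
  count-resp-↭ refl = refl
  count-resp-↭ (prep x p) with S x
  ... | true = cong suc (count-resp-↭ p)
  ... | false = count-resp-↭ p
  count-resp-↭ (swap x y p) with S x | S y
  ... | true | true = cong (suc ∘ suc) (count-resp-↭ p)
  ... | true | false = cong suc (count-resp-↭ p)
  ... | false | true = cong suc (count-resp-↭ p)
  ... | false | false = count-resp-↭ p
  count-resp-↭ (trans p q) = ≡.trans (count-resp-↭ p) (count-resp-↭ q)

  count-none : ∀ {xs} → All (λ v → S v ≡ false) xs → count S xs ≡ 0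
  count-none [] = refl
  count-none {_ ∷ xs} (Sx ∷ Sxs) = ≡.trans (count-∷-false _ xs Sx) (count-none Sxs)

  count≡0⇒false : ∀ {xs y} → count S xs ≡ 0 → y ∈ xs → S y ≢ true
  count≡0⇒false {_ ∷ xs} c (here refl) Sy with () ← ≡.trans (sym (count-∷-true _ xs Sy)) c
  count≡0⇒false {x ∷ _} c (there y∈xs) with S x
  ... | false = count≡0⇒false c y∈xs

  count≡1⇒unique : ∀ {xs x y} → count S xs ≡ 1 → x ∈ xs → y ∈ xs →
                   S x ≡ true → S y ≡ true → x ≡ y
  count≡1⇒unique c (here refl) (here refl) _ _ = refl
  count≡1⇒unique {_ ∷ xs} c (here refl) (there y∈xs) Sx Sy =
    contradiction Sy (count≡0⇒false (suc-injective (≡.trans (sym (count-∷-true _ xs Sx)) c)) y∈xs)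
  count≡1⇒unique {_ ∷ xs} c (there x∈xs) (here refl) Sx Sy =
    contradiction Sx (count≡0⇒false (suc-injective (≡.trans (sym (count-∷-true _ xs Sy)) c)) x∈xs)
  count≡1⇒unique {z ∷ _} c (there x∈xs) (there y∈xs) Sx Sy with S z
  ... | true = contradiction Sx (count≡0⇒false (suc-injective c) x∈xs)
  ... | false = count≡1⇒unique c x∈xs y∈xs Sx Sy

  Orthogonal-avoiding⇒[] : ∀ {Ps} → Orthogonal S Ps → (∀ {z} → z ∈ concat Ps → S z ≢ true) → Ps ≡ []
  Orthogonal-avoiding⇒[] [] _ = refl
  Orthogonal-avoiding⇒[] {P ∷ Ps} (c ∷ _) avoid with () ←
    ≡.trans (sym c) (count-none (All.tabulate (λ z∈P → ¬-not (avoid (∈-++⁺ˡ {ys = concat Ps} z∈P)))))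

module _ (S : Fin n → Bool) {x y : Fin n} (x≢y : x ≢ y) (Sx : S x ≡ true) (Sy : S y ≡ true)
         (S⊆xy : ∀ {z} → S z ≡ true → z ≡ x ⊎ z ≡ y) where

  no-third-path : ∀ {P Q rest} → Orthogonal S rest → Unique (concat (P ∷ Q ∷ rest)) →
                  x ∈ P → y ∈ Q → rest ≡ []
  no-third-path {P} {Q} {rest} orth uniq x∈P y∈Q = Orthogonal-avoiding⇒[] S orth avoid
    where
    disjoint : ∀ {z} → z ∈ P ++ Q → z ∉ concat rest
    disjoint = Unique-++⇒disjoint (P ++ Q) (subst Unique (sym (++-assoc P Q (concat rest))) uniq)
    avoid : ∀ {z} → z ∈ concat rest → S z ≢ true
    avoid z∈rest Sz with S⊆xy Sz
    ... | inj₁ refl = disjoint (∈-++⁺ˡ x∈P) z∈rest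
    ... | inj₂ refl = disjoint (∈-++⁺ʳ P y∈Q) z∈rest

  orthogonal-two-paths : ∀ {Ps} → Orthogonal S Ps → Unique (concat Ps) →
                         x ∈ concat Ps → y ∈ concat Ps →
                         ∃₂ λ P Q → x ∈ P × y ∈ Q × Ps ↭ P ∷ Q ∷ []
  orthogonal-two-paths {Ps} orth uniq x∈ y∈
    with P , Ps′ , x∈P , Ps↭P∷Ps′ ← Any⇒↭∷ (∈-concat⁻ Ps x∈)
    with ∈-++⁻ P (∈-resp-↭ (concat-↭ Ps↭P∷Ps′) y∈)
  ... | inj₁ y∈P =
    contradiction (count≡1⇒unique S (All.head (All-resp-↭ Ps↭P∷Ps′ orth)) x∈P y∈P Sx Sy) x≢y
  ... | inj₂ y∈Ps′
    with Q , rest , y∈Q , Ps′↭Q∷rest ← Any⇒↭∷ (∈-concat⁻ Ps′ y∈Ps′)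
    with Ps↭ ← trans Ps↭P∷Ps′ (prep P Ps′↭Q∷rest)
    with refl ← no-third-path (All.tail (All.tail (All-resp-↭ Ps↭ orth)))
                              (Unique-resp-↭ (concat-↭ Ps↭) uniq) x∈P y∈Q
    = P , Q , x∈P , y∈Q , Ps↭

OrthogonalPathPartition : ∀ {N} → Digraph N → List (Fin N) → (Fin N → Bool) → Set
OrthogonalPathPartition A V S = Σ (List (List (Fin _))) λ Ps → IsPathPartition A V Ps × Orthogonal S Ps

IsPath-mono : ∀ {R R′ : Digraph n} {P} → (∀ {u v} → R′ u v → R u v) → IsPath R′ P → IsPath R P
IsPath-mono R′⊆R (P≢[] , uniq , path) = P≢[] , uniq , Linked.map R′⊆R path

module _ (R : Digraph n) (w : Fin n) where

  Adjacent : Fin n → Set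
  Adjacent v = R w v ⊎ R v w

  -- w goes right before the first vertex it has an arc to, or at the end if there is none.
  insert-after : ∀ {u vs} → R u w → Linked R (u ∷ vs) → All Adjacent vs →
                 ∃ λ vs′ → Linked R (u ∷ vs′) × vs′ ↭ w ∷ vs
  insert-after {vs = []} uw _ _ = w ∷ [] , uw ∷ [-] , ↭-refl
  insert-after {vs = v ∷ vs} uw (_ ∷ path) (inj₁ wv ∷ _) = w ∷ v ∷ vs , uw ∷ wv ∷ path , ↭-refl
  insert-after {vs = v ∷ vs} uw (uv ∷ path) (inj₂ vw ∷ adj)
    with vs′ , path′ , vs′↭ ← insert-after vw path adj =
    v ∷ vs′ , uv ∷ path′ , trans (prep v vs′↭) (swap v w ↭-refl)

  insert-linked : ∀ {P} → Linked R P → All Adjacent P → ∃ λ P′ → Linked R P′ × P′ ↭ w ∷ P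
  insert-linked {[]} _ _ = w ∷ [] , [-] , ↭-refl
  insert-linked {v ∷ vs} path (inj₁ wv ∷ _) = w ∷ v ∷ vs , wv ∷ path , ↭-refl
  insert-linked {v ∷ vs} path (inj₂ vw ∷ adj) with vs′ , path′ , vs′↭ ← insert-after vw path adj =
    v ∷ vs′ , path′ , trans (prep v vs′↭) (swap v w ↭-refl)

  insert-into-path : ∀ {P} → IsPath R P → w ∉ P → All Adjacent P →
                     ∃ λ P′ → IsPath R P′ × P′ ↭ w ∷ P
  insert-into-path {P} (_ , uniq , path) w∉P adj with P′ , path′ , P′↭ ← insert-linked path adj =
    P′ , ((λ { refl → case ↭-empty-inv (↭-sym P′↭) of λ () }) ,
          Unique-resp-↭ (↭-sym P′↭) (¬Any⇒All¬ P w∉P ∷ uniq) , path′) , P′↭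

coCycleAdj : ∀ {N} {u v : Fin N} → 2 + toℕ u ≤ toℕ v → (toℕ u ≡ 0 → suc (toℕ v) ≢ N) →
             CoCycleAdj u v
coCycleAdj {u = u} {v} u+2≤v not-wrap = (λ u≡v → <⇒≢ u<v (cong toℕ u≡v)) , notCycleAdj
  where
  u<v : toℕ u < toℕ v
  u<v = ≤-trans (n≤1+n _) u+2≤v
  notCycleAdj : ¬ CycleAdj u v
  notCycleAdj (inj₁ v≡u+1) = 1+n≰n (subst (2 + toℕ u ≤_) v≡u+1 u+2≤v)
  notCycleAdj (inj₂ (inj₁ u≡v+1)) = <-asym u<v (subst (toℕ v <_) (sym u≡v+1) ≤-refl)
  notCycleAdj (inj₂ (inj₂ (inj₁ (u≡0 , v+1≡N)))) = not-wrap u≡0 v+1≡N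
  notCycleAdj (inj₂ (inj₂ (inj₂ (v≡0 , _)))) with () ← subst (2 + toℕ u ≤_) v≡0 u+2≤v

insert-neighbour : ∀ {N} {A : Digraph N} {w P} → SuperOrientationCoCycle A →
                   IsPath A P → All (CoCycleAdj w) P → ∃ λ P′ → IsPath A P′ × P′ ↭ w ∷ P
insert-neighbour {w = w} so P-path w~P =
  insert-into-path _ w P-path (All¬⇒¬Any (All.map proj₁ w~P)) (All.map (λ {v} → proj₂ (so w v)) w~P)

≢⇒≡ᵇ-false : ∀ {m n} → m ≢ n → (m ≡ᵇ n) ≡ false
≢⇒≡ᵇ-false {m} {n} = dec-false (m ≟ n)

≡ᵇ-∨-true⇔ : ∀ {m a b} → ((m ≡ᵇ a) ∨ (m ≡ᵇ b)) ≡ true ⇔ (m ≡ a ⊎ m ≡ b)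
≡ᵇ-∨-true⇔ {m} {a} {b} = mk⇔
  (Sum.map (≡ᵇ⇒≡ m a) (≡ᵇ⇒≡ m b) ∘ Equivalence.to T-∨ ∘ Equivalence.from T-≡)
  (Equivalence.to T-≡ ∘ Equivalence.from T-∨ ∘ Sum.map (≡⇒≡ᵇ m a) (≡⇒≡ᵇ m b))

allFin≡0∷1∷≥2 : ∀ {n} (u v : Fin (suc n)) → toℕ u ≡ 0 → toℕ v ≡ 1 →
                allFin (suc n) ≡ u ∷ v ∷ filter (λ w → 2 ≤? toℕ w) (allFin (suc n))
allFin≡0∷1∷≥2 fzero (fsuc fzero) refl refl =
  cong (λ ws → fzero ∷ fsuc fzero ∷ ws) (sym (filter-all _ (tabulate⁺ (λ _ → s≤s (s≤s z≤n)))))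

module Labelling (k : ℕ) (3≤k : 3 ≤ k) where

  private
    3≤2k : 3 ≤ 2 * k
    3≤2k = ≤-trans 3≤k (m≤n*m k 2)
    1<1+2k : 1 < suc (2 * k)
    1<1+2k = s≤s (≤-trans (s≤s z≤n) 3≤2k)
    2<1+2k : 2 < suc (2 * k)
    2<1+2k = s≤s (≤-trans (s≤s (s≤s z≤n)) 3≤2k)

  x₀ x₁ x₂ x₂ₖ : Fin (suc (2 * k))
  x₀ = fzero
  x₁ = fromℕ< 1<1+2k
  x₂ = fromℕ< 2<1+2k
  x₂ₖ = fromℕ (2 * k)

  toℕ-x₁ : toℕ x₁ ≡ 1
  toℕ-x₁ = toℕ-fromℕ< 1<1+2k

  toℕ-x₂ : toℕ x₂ ≡ 2
  toℕ-x₂ = toℕ-fromℕ< 2<1+2k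

  toℕ-x₂ₖ : toℕ x₂ₖ ≡ 2 * k
  toℕ-x₂ₖ = toℕ-fromℕ (2 * k)

  x₂≢x₂ₖ : x₂ ≢ x₂ₖ
  x₂≢x₂ₖ x₂≡x₂ₖ = <⇒≢ 3≤2k (≡.trans (sym toℕ-x₂) (≡.trans (cong toℕ x₂≡x₂ₖ) toℕ-x₂ₖ))

  allFin≡x₀∷x₁∷V′ : allFin (suc (2 * k)) ≡ x₀ ∷ x₁ ∷ V' k
  allFin≡x₀∷x₁∷V′ = allFin≡0∷1∷≥2 x₀ x₁ refl toℕ-x₁

  ∈V′⇒2≤ : ∀ {v} → v ∈ V' k → 2 ≤ toℕ v
  ∈V′⇒2≤ = proj₂ ∘ ∈-filter⁻ (λ v → 2 ≤? toℕ v) {xs = allFin _}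

  x₂∈V′ : x₂ ∈ V' k
  x₂∈V′ = ∈-filter⁺ (λ v → 2 ≤? toℕ v) (∈-allFin x₂) (subst (2 ≤_) (sym toℕ-x₂) ≤-refl)

  x₂ₖ∈V′ : x₂ₖ ∈ V' k
  x₂ₖ∈V′ = ∈-filter⁺ (λ v → 2 ≤? toℕ v) (∈-allFin x₂ₖ)
                     (subst (2 ≤_) (sym toℕ-x₂ₖ) (≤-trans (n≤1+n 2) 3≤2k))

  Unique-V′ : Unique (V' k)
  Unique-V′ = filter⁺ (λ v → 2 ≤? toℕ v) (allFin⁺ _)

  S₂-x₂ : S₂ k x₂ ≡ true
  S₂-x₂ = Equivalence.from (≡ᵇ-∨-true⇔ {b = 2 * k}) (inj₁ toℕ-x₂)

  S₂-x₂ₖ : S₂ k x₂ₖ ≡ true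
  S₂-x₂ₖ = Equivalence.from (≡ᵇ-∨-true⇔ {a = 2}) (inj₂ toℕ-x₂ₖ)

  S₂⊆x₂x₂ₖ : ∀ {v} → S₂ k v ≡ true → v ≡ x₂ ⊎ v ≡ x₂ₖ
  S₂⊆x₂x₂ₖ = Sum.map (λ e → toℕ-injective (≡.trans e (sym toℕ-x₂)))
                     (λ e → toℕ-injective (≡.trans e (sym toℕ-x₂ₖ)))
           ∘ Equivalence.to ≡ᵇ-∨-true⇔

  S₀-false-on-N[x₀] : ∀ {v} → CoCycleAdj x₀ v → S₀ k v ≡ false
  S₀-false-on-N[x₀] (x₀≢v , ¬x₀~v) = cong₂ _∨_
    (≢⇒≡ᵇ-false (x₀≢v ∘ toℕ-injective ∘ sym))
    (≢⇒≡ᵇ-false λ v≡2k → ¬x₀~v (inj₂ (inj₂ (inj₁ (refl , cong suc v≡2k)))))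

  S₀-x₁ : S₀ k x₁ ≡ false
  S₀-x₁ rewrite toℕ-x₁ = ≢⇒≡ᵇ-false (<⇒≢ (≤-trans (n≤1+n 2) 3≤2k))

  S₀≡S₂-on-N[x₁] : ∀ {v} → CoCycleAdj x₁ v → S₀ k v ≡ S₂ k v
  S₀≡S₂-on-N[x₁] {v} (_ , ¬x₁~v) = cong (_∨ (toℕ v ≡ᵇ 2 * k)) (≡.trans
    (≢⇒≡ᵇ-false λ v≡0 → ¬x₁~v (inj₂ (inj₁ (≡.trans toℕ-x₁ (cong suc (sym v≡0))))))
    (sym (≢⇒≡ᵇ-false λ v≡2 → ¬x₁~v (inj₁ (≡.trans v≡2 (cong suc (sym toℕ-x₁)))))))

  neighbours-of-cover : ∀ {P Q} → P ++ Q ++ [] ↭ V' k → x₂ ∈ P → x₂ₖ ∈ Q →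
                        All (CoCycleAdj x₀) P × All (CoCycleAdj x₁) Q
  neighbours-of-cover {P} {Q} cover x₂∈P x₂ₖ∈Q = All.tabulate x₀~ , All.tabulate x₁~
    where
    uniq : Unique (P ++ Q ++ [])
    uniq = Unique-resp-↭ (↭-sym cover) Unique-V′
    2≤ : ∀ {v} → v ∈ P ++ Q ++ [] → 2 ≤ toℕ v
    2≤ = ∈V′⇒2≤ ∘ ∈-resp-↭ cover
    x₀~ : ∀ {v} → v ∈ P → CoCycleAdj x₀ v
    x₀~ v∈P = coCycleAdj (2≤ (∈-++⁺ˡ v∈P)) λ _ v+1≡1+2k →
      Unique-++⇒disjoint P uniq
        (subst (_∈ P) (toℕ-injective (≡.trans (suc-injective v+1≡1+2k) (sym toℕ-x₂ₖ))) v∈P)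
        (∈-++⁺ˡ x₂ₖ∈Q)
    x₁~ : ∀ {v} → v ∈ Q → CoCycleAdj x₁ v
    x₁~ {v} v∈Q = coCycleAdj (subst (λ m → 2 + m ≤ toℕ v) (sym toℕ-x₁) 3≤v) λ x₁≡0 →
      case ≡.trans (sym toℕ-x₁) x₁≡0 of λ ()
      where
      3≤v : 3 ≤ toℕ v
      3≤v = ≤∧≢⇒< (2≤ (∈-++⁺ʳ P (∈-++⁺ˡ v∈Q))) λ 2≡v →
        Unique-++⇒disjoint P uniq x₂∈P
          (∈-++⁺ˡ (subst (_∈ Q) (toℕ-injective (≡.trans (sym 2≡v) (sym toℕ-x₂))) v∈Q))

  record TwoPathCover (A : Digraph (suc (2 * k))) : Set where
    field
      P Q : List (Fin (suc (2 * k)))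
      P-path : IsPath A P
      Q-path : IsPath A Q
      cover : P ++ Q ++ [] ↭ V' k
      P⊆N[x₀] : All (CoCycleAdj x₀) P
      Q⊆N[x₁] : All (CoCycleAdj x₁) Q
      Q-orthogonal : count (S₂ k) Q ≡ 1

  open TwoPathCover using (P-path; Q-path; cover; P⊆N[x₀]; Q⊆N[x₁]; Q-orthogonal)

  two-path-cover : ∀ {A} → OrthogonalPathPartition (D' k A) (V' k) (S₂ k) → TwoPathCover A
  two-path-cover (Ps , (paths , cover) , orth)
    with P , Q , x₂∈P , x₂ₖ∈Q , Ps↭ ← orthogonal-two-paths (S₂ k) x₂≢x₂ₖ S₂-x₂ S₂-x₂ₖ S₂⊆x₂x₂ₖ orth
           (Unique-resp-↭ (↭-sym cover) Unique-V′)
           (∈-resp-↭ (↭-sym cover) x₂∈V′) (∈-resp-↭ (↭-sym cover) x₂ₖ∈V′)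
    with P-path ∷ Q-path ∷ [] ← All-resp-↭ Ps↭ paths
    with _ ∷ Q-orthogonal ∷ [] ← All-resp-↭ Ps↭ orth
    with PQ-cover ← trans (concat-↭ (↭-sym Ps↭)) cover
    with P⊆N[x₀] , Q⊆N[x₁] ← neighbours-of-cover PQ-cover x₂∈P x₂ₖ∈Q
    = record
      { P = P ; Q = Q
      ; P-path = IsPath-mono proj₁ P-path ; Q-path = IsPath-mono proj₁ Q-path
      ; cover = PQ-cover
      ; P⊆N[x₀] = P⊆N[x₀] ; Q⊆N[x₁] = Q⊆N[x₁]
      ; Q-orthogonal = Q-orthogonal
      }

  x₀x₁-cover : ∀ {P Q P′ Q′} → P′ ↭ x₀ ∷ P → Q′ ↭ x₁ ∷ Q → P ++ Q ++ [] ↭ V' k →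
               P′ ++ Q′ ++ [] ↭ allFin (suc (2 * k))
  x₀x₁-cover {P} {Q} {P′} {Q′} P′↭ Q′↭ cover = begin
    P′ ++ Q′ ++ []              ↭⟨ ++⁺ P′↭ (++⁺ʳ [] Q′↭) ⟩
    x₀ ∷ P ++ x₁ ∷ Q ++ []      ↭⟨ prep x₀ (shift x₁ P (Q ++ [])) ⟩
    x₀ ∷ x₁ ∷ P ++ Q ++ []      ↭⟨ prep x₀ (prep x₁ cover) ⟩
    x₀ ∷ x₁ ∷ V' k              ≡⟨ sym allFin≡x₀∷x₁∷V′ ⟩
    allFin (suc (2 * k))        ∎
    where open PermutationReasoning

  module _ {A : Digraph (suc (2 * k))} (so : SuperOrientationCoCycle A) where

    add-x₀ : ∀ {P} → IsPath A P → All (CoCycleAdj x₀) P →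
             ∃ λ P′ → IsPath A P′ × P′ ↭ x₀ ∷ P × count (S₀ k) P′ ≡ 1
    add-x₀ {P} P-path P⊆N[x₀]
      with P′ , P′-path , P′↭ ← insert-neighbour so P-path P⊆N[x₀] =
      P′ , P′-path , P′↭ , (begin
        count (S₀ k) P′        ≡⟨ count-resp-↭ (S₀ k) P′↭ ⟩
        count (S₀ k) (x₀ ∷ P)  ≡⟨ count-∷-true (S₀ k) x₀ P refl ⟩
        suc (count (S₀ k) P)   ≡⟨ cong suc (count-none (S₀ k) (All.map S₀-false-on-N[x₀] P⊆N[x₀])) ⟩
        1                      ∎)
      where open ≡.≡-Reasoning

    add-x₁ : ∀ {Q} → IsPath A Q → All (CoCycleAdj x₁) Q → count (S₂ k) Q ≡ 1 →
             ∃ λ Q′ → IsPath A Q′ × Q′ ↭ x₁ ∷ Q × count (S₀ k) Q′ ≡ 1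
    add-x₁ {Q} Q-path Q⊆N[x₁] Q-orthogonal
      with Q′ , Q′-path , Q′↭ ← insert-neighbour so Q-path Q⊆N[x₁] =
      Q′ , Q′-path , Q′↭ , (begin
        count (S₀ k) Q′        ≡⟨ count-resp-↭ (S₀ k) Q′↭ ⟩
        count (S₀ k) (x₁ ∷ Q)  ≡⟨ count-∷-false (S₀ k) x₁ Q S₀-x₁ ⟩
        count (S₀ k) Q         ≡⟨ count-cong (S₀ k) (All.map S₀≡S₂-on-N[x₁] Q⊆N[x₁]) ⟩
        count (S₂ k) Q         ≡⟨ Q-orthogonal ⟩
        1                      ∎)
      where open ≡.≡-Reasoning

    extend-cover : TwoPathCover A → OrthogonalPathPartition A (allFin (suc (2 * k))) (S₀ k)
    extend-cover c
      with P′ , P′-path , P′↭ , P′-orthogonal ← add-x₀ (P-path c) (P⊆N[x₀] c)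
      with Q′ , Q′-path , Q′↭ , Q′-orthogonal ← add-x₁ (Q-path c) (Q⊆N[x₁] c) (Q-orthogonal c)
      = P′ ∷ Q′ ∷ [] ,
        ((P′-path ∷ Q′-path ∷ []) , x₀x₁-cover P′↭ Q′↭ (cover c)) ,
        P′-orthogonal ∷ Q′-orthogonal ∷ []

corollary2 : (k : ℕ) → 3 ≤ k → (A : Digraph (suc (2 * k))) →
    SuperOrientationCoCycle A →
    Σ (List (List (Fin (suc (2 * k))))) (λ Ps → IsPathPartition (D' k A) (V' k) Ps × Orthogonal (S₂ k) Ps) →
    Σ (List (List (Fin (suc (2 * k))))) (λ Ps → IsPathPartition A (allFin (suc (2 * k))) Ps × Orthogonal (S₀ k) Ps)
corollary2 k 3≤k A so = extend-cover so ∘ two-path-cover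
  where open Labelling k 3≤k
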